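{- Let $G=(V,E)$ be a connected graph with at least two vertices and $\mu$ an irredundant $k$-expression for $G$. For every node $t$ of the syntax tree of $\mu$ and every nonempty label $\ell\in L_t$, either $V_t^\ell\cap D_t=\emptyset$ or $V_t^\ell\subseteq D_t$.
   Context: Clique-expressions use operations introduce, disjoint union, relabel $\rho_{i\to j}$, join $\eta_{i,j}$ ($i\ne j$, adds all edges between label-$i$ and label-$j$ vertices); a $k$-expression uses labels $1,\dots,k$ only. For a syntax-tree node $t$, $G_t=(V_t,E_t)$ is the labeled graph built by the subexpression at $t$, $V_t^\ell$ its vertices of label $\ell$, and $L_t=\{\ell: V_t^\ell\ne\emptyset\}$. Irredundant: at every join node $\eta_{i,j}(G_{t'})$ ($t'$ the child), $G_{t'}$ has no edge between $V_{t'}^i$ and $V_{t'}^j$. The set of dead vertices at $t$ is $D_t=\{v\in V_t:\delta_G(v)\subseteq E_t\}$, where $\delta_G(v)$ is the set of edges of $G$ incident to $v$. -}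

module Defs where

open import Data.Nat using (ℕ; _≥_)
open import Data.Fin using (Fin)
open import Data.Product using (Σ; ∃; _×_; _,_)
open import Data.Sum using (_⊎_)
open import Data.Empty using (⊥)
open import Relation.Nullary using (¬_)
open import Relation.Binary using (Decidable)
open import Relation.Binary.PropositionalEquality using (_≡_; _≢_)
open import Relation.Binary.Construct.Closure.ReflexiveTransitive using (Star)

record Graph : Set₁ where
  field
    n     : ℕ
    Adj   : Fin n → Fin n → Set
    adj?  : Decidable Adj
    sym   : ∀ {u v} → Adj u v → Adj v u
    irrefl : ∀ {u} → ¬ Adj u u
open Graph public

Connected : Graph → Set
Connected G = ∀ (u v : Fin (n G)) → Star (Adj G) u v

-- Clique-expressions with labels Fin k, over vertex names Fin n

data Expr (n k : ℕ) : Set where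
  intro : Fin n → Fin k → Expr n k
  _⊕_   : Expr n k → Expr n k → Expr n k
  relab : (i j : Fin k) → Expr n k → Expr n k
  join  : (i j : Fin k) → i ≢ j → Expr n k → Expr n k

module _ {n k : ℕ} where

  -- HasLabel t v ℓ : v ∈ V_t^ℓ
  data HasLabel : Expr n k → Fin n → Fin k → Set where
    lab-intro : ∀ {v i} → HasLabel (intro v i) v i
    lab-⊕ˡ    : ∀ {s t v ℓ} → HasLabel s v ℓ → HasLabel (s ⊕ t) v ℓ
    lab-⊕ʳ    : ∀ {s t v ℓ} → HasLabel t v ℓ → HasLabel (s ⊕ t) v ℓ
    lab-ρ     : ∀ {i j t v} → HasLabel t v i → HasLabel (relab i j t) v j
    lab-ρ-keep : ∀ {i j t v ℓ} → HasLabel t v ℓ → ℓ ≢ i → HasLabel (relab i j t) v ℓ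
    lab-η     : ∀ {i j p t v ℓ} → HasLabel t v ℓ → HasLabel (join i j p t) v ℓ

  InV : Expr n k → Fin n → Set
  InV t v = ∃ λ ℓ → HasLabel t v ℓ

  -- Edge t u v : the edge uv is in E_t (symmetric by construction)
  data Edge : Expr n k → Fin n → Fin n → Set where
    e-⊕ˡ  : ∀ {s t u v} → Edge s u v → Edge (s ⊕ t) u v
    e-⊕ʳ  : ∀ {s t u v} → Edge t u v → Edge (s ⊕ t) u v
    e-ρ   : ∀ {i j t u v} → Edge t u v → Edge (relab i j t) u v
    e-η   : ∀ {i j p t u v} → Edge t u v → Edge (join i j p t) u v
    e-new : ∀ {i j p t u v} → HasLabel t u i → HasLabel t v j → Edge (join i j p t) u v
    e-new' : ∀ {i j p t u v} → HasLabel t u j → HasLabel t v i → Edge (join i j p t) u v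

  data WellFormed : Expr n k → Set where
    wf-intro : ∀ {v i} → WellFormed (intro v i)
    wf-⊕     : ∀ {s t} → WellFormed s → WellFormed t
             → (∀ v → InV s v → InV t v → ⊥) → WellFormed (s ⊕ t)
    wf-ρ     : ∀ {i j t} → WellFormed t → WellFormed (relab i j t)
    wf-η     : ∀ {i j p t} → WellFormed t → WellFormed (join i j p t)

  -- t is a node (subexpression) of the syntax tree of μ
  data _≼_ : Expr n k → Expr n k → Set where
    here  : ∀ {t} → t ≼ t
    in-⊕ˡ : ∀ {t s s'} → t ≼ s → t ≼ (s ⊕ s')
    in-⊕ʳ : ∀ {t s s'} → t ≼ s' → t ≼ (s ⊕ s')
    in-ρ  : ∀ {t i j s} → t ≼ s → t ≼ relab i j s
    in-η  : ∀ {t i j p s} → t ≼ s → t ≼ join i j p s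

  Irredundant : Expr n k → Set
  Irredundant μ = ∀ {i j p t'} → join i j p t' ≼ μ →
    ∀ u v → HasLabel t' u i → HasLabel t' v j → ¬ Edge t' u v

record IsExprFor {k : ℕ} (G : Graph) (μ : Expr (n G) k) : Set where
  field
    wf       : WellFormed μ
    covers   : ∀ v → InV μ v
    edges→   : ∀ {u v} → Edge μ u v → Adj G u v
    edges←   : ∀ {u v} → Adj G u v → Edge μ u v

-- dead vertices at t: v ∈ V_t with δ_G(v) ⊆ E_t
Dead : {k : ℕ} (G : Graph) → Expr (n G) k → Fin (n G) → Set
Dead G t v = InV t v × (∀ w → Adj G v w → Edge t v w)

{-# OPTIONS --safe #-}
module Submission where

-- If u and v carry the same label at t and u is dead at t, so is v. Any edge vw of G
-- missing from E_t is created by a join η_{i,j} above t where v and w carry the labels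
-- i and j. Labels that agree at t agree at every later node, so that join also creates
-- uw; since u is dead at t, uw already lies in E_t, hence below the join, contradicting
-- irredundancy. Deadness of a vertex is decidable, so testing one vertex of label ℓ
-- settles the dichotomy.

open import Defs
open import Data.Nat using (ℕ; _≥_)
open import Data.Fin using (Fin)
open import Data.Fin.Properties using (all?) renaming (_≟_ to _≟F_)
open import Data.Product using (∃; _×_; _,_; proj₂)
open import Data.Sum using (_⊎_; inj₁; inj₂)
open import Data.Empty using (⊥-elim)
open import Relation.Nullary using (¬_; Dec; yes; no)
open import Relation.Nullary.Decidable using (map′; _×-dec_; _⊎-dec_; _→-dec_; ¬?)
open import Relation.Binary.PropositionalEquality using (_≡_; refl; subst) renaming (sym to ≡-sym)

module _ {n k : ℕ} where

  InV-relab : ∀ {i j t v} → InV {n} {k} t v → InV (relab i j t) v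
  InV-relab {i} {j} (m , h) with m ≟F i
  ... | yes refl = j , lab-ρ h
  ... | no m≢i   = m , lab-ρ-keep h m≢i

  InV-mono : ∀ {t s : Expr n k} → t ≼ s → ∀ {v} → InV t v → InV s v
  InV-mono here      h = h
  InV-mono (in-⊕ˡ p) h with InV-mono p h
  ... | m , h′ = m , lab-⊕ˡ h′
  InV-mono (in-⊕ʳ p) h with InV-mono p h
  ... | m , h′ = m , lab-⊕ʳ h′
  InV-mono (in-ρ p)  h = InV-relab (InV-mono p h)
  InV-mono (in-η p)  h with InV-mono p h
  ... | m , h′ = m , lab-η h′

  Edge⇒InV : ∀ {t : Expr n k} {u w} → Edge t u w → InV t u
  Edge⇒InV (e-⊕ˡ e)    with Edge⇒InV e
  ... | m , h = m , lab-⊕ˡ h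
  Edge⇒InV (e-⊕ʳ e)    with Edge⇒InV e
  ... | m , h = m , lab-⊕ʳ h
  Edge⇒InV (e-ρ e)     = InV-relab (Edge⇒InV e)
  Edge⇒InV (e-η e)     with Edge⇒InV e
  ... | m , h = m , lab-η h
  Edge⇒InV (e-new a _)  = _ , lab-η a
  Edge⇒InV (e-new' a _) = _ , lab-η a

  Edge-sym : ∀ {t : Expr n k} {u w} → Edge t u w → Edge t w u
  Edge-sym (e-⊕ˡ e)     = e-⊕ˡ (Edge-sym e)
  Edge-sym (e-⊕ʳ e)     = e-⊕ʳ (Edge-sym e)
  Edge-sym (e-ρ e)      = e-ρ (Edge-sym e)
  Edge-sym (e-η e)      = e-η (Edge-sym e)
  Edge-sym (e-new a b)  = e-new' b a
  Edge-sym (e-new' a b) = e-new b a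

  Edge-mono : ∀ {t s : Expr n k} → t ≼ s → ∀ {u w} → Edge t u w → Edge s u w
  Edge-mono here      e = e
  Edge-mono (in-⊕ˡ p) e = e-⊕ˡ (Edge-mono p e)
  Edge-mono (in-⊕ʳ p) e = e-⊕ʳ (Edge-mono p e)
  Edge-mono (in-ρ p)  e = e-ρ (Edge-mono p e)
  Edge-mono (in-η p)  e = e-η (Edge-mono p e)

  WellFormed-≼ : ∀ {t s : Expr n k} → t ≼ s → WellFormed s → WellFormed t
  WellFormed-≼ here      w            = w
  WellFormed-≼ (in-⊕ˡ p) (wf-⊕ w _ _) = WellFormed-≼ p w
  WellFormed-≼ (in-⊕ʳ p) (wf-⊕ _ w _) = WellFormed-≼ p w
  WellFormed-≼ (in-ρ p)  (wf-ρ w)     = WellFormed-≼ p w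
  WellFormed-≼ (in-η p)  (wf-η w)     = WellFormed-≼ p w

  WellFormed-join⁻ : ∀ {i j p} {t : Expr n k} → WellFormed (join i j p t) → WellFormed t
  WellFormed-join⁻ (wf-η w) = w

  label-unique : ∀ {t : Expr n k} → WellFormed t → ∀ {v a b} →
    HasLabel t v a → HasLabel t v b → a ≡ b
  label-unique wf-intro     lab-intro  lab-intro  = refl
  label-unique (wf-⊕ w _ _) (lab-⊕ˡ x) (lab-⊕ˡ y) = label-unique w x y
  label-unique (wf-⊕ _ _ d) (lab-⊕ˡ x) (lab-⊕ʳ y) = ⊥-elim (d _ (_ , x) (_ , y))
  label-unique (wf-⊕ _ _ d) (lab-⊕ʳ x) (lab-⊕ˡ y) = ⊥-elim (d _ (_ , y) (_ , x))
  label-unique (wf-⊕ _ w _) (lab-⊕ʳ x) (lab-⊕ʳ y) = label-unique w x y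
  label-unique (wf-ρ _)     (lab-ρ _)  (lab-ρ _)  = refl
  label-unique (wf-ρ w)     (lab-ρ x)  (lab-ρ-keep y b≢i) = ⊥-elim (b≢i (≡-sym (label-unique w x y)))
  label-unique (wf-ρ w)     (lab-ρ-keep x a≢i) (lab-ρ y) = ⊥-elim (a≢i (label-unique w x y))
  label-unique (wf-ρ w)     (lab-ρ-keep x _) (lab-ρ-keep y _) = label-unique w x y
  label-unique (wf-η w)     (lab-η x)  (lab-η y)  = label-unique w x y

  sameLabel-≼ : ∀ {t s : Expr n k} → t ≼ s → WellFormed s → ∀ {u v ℓ m} →
    HasLabel t u ℓ → HasLabel t v ℓ → HasLabel s v m → HasLabel s u m
  sameLabel-≼ here      w            hu hv x = subst (HasLabel _ _) (label-unique w hv x) hu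
  sameLabel-≼ (in-⊕ˡ p) (wf-⊕ w _ _) hu hv (lab-⊕ˡ x) = lab-⊕ˡ (sameLabel-≼ p w hu hv x)
  sameLabel-≼ (in-⊕ˡ p) (wf-⊕ _ _ d) hu hv (lab-⊕ʳ x) = ⊥-elim (d _ (InV-mono p (_ , hv)) (_ , x))
  sameLabel-≼ (in-⊕ʳ p) (wf-⊕ _ _ d) hu hv (lab-⊕ˡ x) = ⊥-elim (d _ (_ , x) (InV-mono p (_ , hv)))
  sameLabel-≼ (in-⊕ʳ p) (wf-⊕ _ w _) hu hv (lab-⊕ʳ x) = lab-⊕ʳ (sameLabel-≼ p w hu hv x)
  sameLabel-≼ (in-ρ p)  (wf-ρ w)     hu hv (lab-ρ x)  = lab-ρ (sameLabel-≼ p w hu hv x)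
  sameLabel-≼ (in-ρ p)  (wf-ρ w)     hu hv (lab-ρ-keep x m≢i) = lab-ρ-keep (sameLabel-≼ p w hu hv x) m≢i
  sameLabel-≼ (in-η p)  (wf-η w)     hu hv (lab-η x)  = lab-η (sameLabel-≼ p w hu hv x)

  Crosses : Fin k → Fin k → Expr n k → Fin n → Fin n → Set
  Crosses i j t v w = (HasLabel t v i × HasLabel t w j) ⊎ (HasLabel t v j × HasLabel t w i)

  Crosses⇒Edge : ∀ {i j p t v w} → Crosses i j t v w → Edge (join i j p t) v w
  Crosses⇒Edge (inj₁ (a , b)) = e-new a b
  Crosses⇒Edge (inj₂ (a , b)) = e-new' a b

  Crosses-transfer : ∀ {i j t u v w} → (∀ {m} → HasLabel t v m → HasLabel t u m) →
    Crosses i j t v w → Crosses i j t u w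
  Crosses-transfer v⇒u (inj₁ (a , b)) = inj₁ (v⇒u a , b)
  Crosses-transfer v⇒u (inj₂ (a , b)) = inj₂ (v⇒u a , b)

  Irredundant⇒¬Crosses-edge : ∀ {μ i j p t u w} → Irredundant μ → join i j p t ≼ μ →
    Crosses i j t u w → ¬ Edge t u w
  Irredundant⇒¬Crosses-edge irr q (inj₁ (a , b)) e = irr q _ _ a b e
  Irredundant⇒¬Crosses-edge irr q (inj₂ (a , b)) e = irr q _ _ b a (Edge-sym e)

  data EdgeOrigin (t s : Expr n k) (v w : Fin n) : Set where
    old : Edge t v w → EdgeOrigin t s v w
    new : ∀ {i j p s′} → join i j p s′ ≼ s → t ≼ s′ → Crosses i j s′ v w → EdgeOrigin t s v w

  edgeOrigin : ∀ {t s : Expr n k} → t ≼ s → WellFormed s → ∀ {v w} → InV t v →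
    Edge s v w → EdgeOrigin t s v w
  edgeOrigin here _ _ e = old e
  edgeOrigin (in-⊕ˡ p) (wf-⊕ w _ _) hv (e-⊕ˡ e) with edgeOrigin p w hv e
  ... | old e′      = old e′
  ... | new q r c   = new (in-⊕ˡ q) r c
  edgeOrigin (in-⊕ˡ p) (wf-⊕ _ _ d) hv (e-⊕ʳ e) = ⊥-elim (d _ (InV-mono p hv) (Edge⇒InV e))
  edgeOrigin (in-⊕ʳ p) (wf-⊕ _ _ d) hv (e-⊕ˡ e) = ⊥-elim (d _ (Edge⇒InV e) (InV-mono p hv))
  edgeOrigin (in-⊕ʳ p) (wf-⊕ _ w _) hv (e-⊕ʳ e) with edgeOrigin p w hv e
  ... | old e′      = old e′
  ... | new q r c   = new (in-⊕ʳ q) r c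
  edgeOrigin (in-ρ p) (wf-ρ w) hv (e-ρ e) with edgeOrigin p w hv e
  ... | old e′      = old e′
  ... | new q r c   = new (in-ρ q) r c
  edgeOrigin (in-η p) (wf-η w) hv (e-η e) with edgeOrigin p w hv e
  ... | old e′      = old e′
  ... | new q r c   = new (in-η q) r c
  edgeOrigin (in-η p) (wf-η _) _ (e-new a b)  = new here p (inj₁ (a , b))
  edgeOrigin (in-η p) (wf-η _) _ (e-new' a b) = new here p (inj₂ (a , b))

  hasLabel? : (t : Expr n k) → ∀ v ℓ → Dec (HasLabel t v ℓ)
  hasLabel? (intro w i) v ℓ with v ≟F w | ℓ ≟F i
  ... | yes refl | yes refl = yes lab-intro
  ... | no v≢w   | _        = no λ { lab-intro → v≢w refl }
  ... | yes _    | no ℓ≢i   = no λ { lab-intro → ℓ≢i refl }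
  hasLabel? (s ⊕ t) v ℓ = map′ from to (hasLabel? s v ℓ ⊎-dec hasLabel? t v ℓ)
    where
    from : HasLabel s v ℓ ⊎ HasLabel t v ℓ → HasLabel (s ⊕ t) v ℓ
    from (inj₁ x) = lab-⊕ˡ x
    from (inj₂ x) = lab-⊕ʳ x
    to : HasLabel (s ⊕ t) v ℓ → HasLabel s v ℓ ⊎ HasLabel t v ℓ
    to (lab-⊕ˡ x) = inj₁ x
    to (lab-⊕ʳ x) = inj₂ x
  hasLabel? (relab i j t) v ℓ =
    map′ from to (((ℓ ≟F j) ×-dec hasLabel? t v i) ⊎-dec (¬? (ℓ ≟F i) ×-dec hasLabel? t v ℓ))
    where
    from : (ℓ ≡ j × HasLabel t v i) ⊎ (¬ ℓ ≡ i × HasLabel t v ℓ) → HasLabel (relab i j t) v ℓ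
    from (inj₁ (refl , x)) = lab-ρ x
    from (inj₂ (ℓ≢i , x))  = lab-ρ-keep x ℓ≢i
    to : HasLabel (relab i j t) v ℓ → (ℓ ≡ j × HasLabel t v i) ⊎ (¬ ℓ ≡ i × HasLabel t v ℓ)
    to (lab-ρ x)          = inj₁ (refl , x)
    to (lab-ρ-keep x ℓ≢i) = inj₂ (ℓ≢i , x)
  hasLabel? (join i j p t) v ℓ = map′ lab-η (λ { (lab-η x) → x }) (hasLabel? t v ℓ)

  edge? : (t : Expr n k) → ∀ u w → Dec (Edge t u w)
  edge? (intro _ _) u w = no λ ()
  edge? (s ⊕ t) u w = map′ from to (edge? s u w ⊎-dec edge? t u w)
    where
    from : Edge s u w ⊎ Edge t u w → Edge (s ⊕ t) u w
    from (inj₁ x) = e-⊕ˡ x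
    from (inj₂ x) = e-⊕ʳ x
    to : Edge (s ⊕ t) u w → Edge s u w ⊎ Edge t u w
    to (e-⊕ˡ x) = inj₁ x
    to (e-⊕ʳ x) = inj₂ x
  edge? (relab i j t) u w = map′ e-ρ (λ { (e-ρ x) → x }) (edge? t u w)
  edge? (join i j p t) u w =
    map′ from to (edge? t u w ⊎-dec ((hasLabel? t u i ×-dec hasLabel? t w j)
                                 ⊎-dec (hasLabel? t u j ×-dec hasLabel? t w i)))
    where
    from : Edge t u w ⊎ Crosses i j t u w → Edge (join i j p t) u w
    from (inj₁ x) = e-η x
    from (inj₂ c) = Crosses⇒Edge c
    to : Edge (join i j p t) u w → Edge t u w ⊎ Crosses i j t u w
    to (e-η x)      = inj₁ x
    to (e-new a b)  = inj₂ (inj₁ (a , b))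
    to (e-new' a b) = inj₂ (inj₂ (a , b))

Dead-sameLabel : (G : Graph) {k : ℕ} {μ t : Expr (n G) k} → IsExprFor G μ → Irredundant μ →
  t ≼ μ → ∀ {ℓ u v} → HasLabel t u ℓ → HasLabel t v ℓ → Dead G t u → Dead G t v
Dead-sameLabel G {t = t} ie irr tμ {u = u} {v} hu hv (_ , u-dead) = (_ , hv) , v-dead
  where
  open IsExprFor ie
  v-dead : ∀ w → Adj G v w → Edge t v w
  v-dead w vw with edgeOrigin tμ wf (_ , hv) (edges← vw)
  ... | old e = e
  ... | new {i} {j} {_} {s′} q r c =
    ⊥-elim (Irredundant⇒¬Crosses-edge irr q c′ (Edge-mono r (u-dead w uw)))
    where
    c′ : Crosses i j s′ u w
    c′ = Crosses-transfer (sameLabel-≼ r (WellFormed-join⁻ (WellFormed-≼ q wf)) hu hv) c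
    uw : Adj G u w
    uw = edges→ (Edge-mono q (Crosses⇒Edge c′))

lemma14 : (G : Graph) → Connected G → n G ≥ 2 →
    (k : ℕ) (μ : Expr (n G) k) → IsExprFor G μ → Irredundant μ →
    ∀ (t : Expr (n G) k) → t ≼ μ →
    ∀ (ℓ : Fin k) → (∃ λ v → HasLabel t v ℓ) →
    (∀ v → HasLabel t v ℓ → ¬ Dead G t v) ⊎ (∀ v → HasLabel t v ℓ → Dead G t v)
lemma14 G _ _ k μ ie irr t tμ ℓ (v₀ , h₀)
  with all? (λ w → adj? G v₀ w →-dec edge? t v₀ w)
... | yes v₀-dead = inj₂ λ v hv → Dead-sameLabel G ie irr tμ h₀ hv ((_ , h₀) , v₀-dead)
... | no v₀-alive = inj₁ λ v hv v-dead → v₀-alive (proj₂ (Dead-sameLabel G ie irr tμ hv h₀ v-dead))
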